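{- Let $n$ be a positive integer such that either (i) $p_1^4\mid n$ for some prime $p_1$, or (ii) $p_1p_2p_3\mid n$ for some distinct primes $p_1,p_2,p_3$, or (iii) $p_1p_2^2\mid n$ for some distinct primes $p_1,p_2$. Then $\omega(M_n)>3$.
   Context: For an integer $n\ge 0$, $M_n=2^n-1$ denotes the $n$-th Mersenne number. For a positive integer $m$, $\omega(m)$ denotes the number of distinct prime divisors of $m$. -}

module Defs where

open import Data.Nat using (ℕ; suc; _∸_; _^_)
open import Data.Nat.Divisibility using (_∣?_)
open import Data.Nat.Primality using (prime?)
open import Data.List using (List; filter; length; upTo)
open import Relation.Nullary.Decidable using (_×-dec_)

M : ℕ → ℕ
M n = 2 ^ n ∸ 1

-- ω(m): number of distinct primes dividing m, counted as the number of
-- primes p in {0,…,m} with p ∣ m (every prime divisor of a positive m is ≤ m).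
ω : ℕ → ℕ
ω m = length (filter (λ p → prime? p ×-dec (p ∣? m)) (upTo (suc m)))

{-# OPTIONS --safe #-}
-- Writing R_m(k) = Σ_{i<k} (1+m)^i, one has M(ak) = M a · R_{M a}(k) and R_m(k) ≡ k + m·k(k−1)/2
-- (mod m²). Hence a prime common to M a and R_{M a}(p), p prime, must be p, and p² does not divide
-- R_{M a}(p); as R_{M a}(p) > p, M(pa) has a prime factor not dividing M a. For distinct primes
-- p, q the primes shared by Φ = M(pq)/(M p · M q) and M p · M q are among p, q and divide Φ only
-- once, while Φ > pq unless {p,q} = {2,3}; so M(pq) has a prime factor dividing neither M p nor M q.
-- Bézout gives gcd(M a, M b) = 1 for coprime a, b, and four distinct prime factors of M n come from
-- the chain M p ∣ M(p²) ∣ M(p³) ∣ M(p⁴), from M p, M q, M r, M(pq), or from M p, M q, M(q²), M(pq);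
-- when pq = 6 one reorders the primes or checks M 12 and M 18 directly.
module Submission where

open import Defs
open import Data.Nat using (ℕ; _*_; _^_; _<_)
open import Data.Nat.Divisibility using (_∣_)
open import Data.Nat.Primality using (Prime)
open import Data.Product using (∃-syntax; _×_)
open import Data.Sum using (_⊎_)
open import Relation.Binary.PropositionalEquality using (_≢_)

open import Data.Nat.Base
open import Data.Nat.Properties
open import Data.Nat.Divisibility
open import Data.Nat.Coprimality as Coprimality using (Coprime; coprime-Bézout; coprime-divisor)
open import Data.Nat.GCD using (module Bézout)
open import Data.Nat.Primality
open import Data.Nat.Primality.Factorisation using (factorise)
open import Data.Nat.ListAction using (product)
open import Data.Nat.Induction using (<-wellFounded)
open import Data.Nat.Tactic.RingSolver using (solve-∀)
open import Induction.WellFounded using (Acc; acc)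
open import Data.List using (List; []; _∷_; length; filter; upTo)
open import Data.List.Membership.Propositional using (_∈_)
open import Data.List.Membership.Propositional.Properties using (∈-filter⁺; ∈-upTo⁺)
open import Data.List.Relation.Binary.Subset.Propositional using (_⊆_)
open import Data.List.Relation.Unary.All as All using (All; []; _∷_)
open import Data.List.Relation.Unary.Any using (here; there)
open import Data.List.Relation.Unary.Unique.Propositional using (Unique; []; _∷_)
open import Data.List.Relation.Unary.Unique.DecPropositional _≟_ using (unique?)
open import Data.Product using (_,_; map₁; map₂)
open import Data.Sum using (inj₁; inj₂; [_,_]′)
open import Function using (_∘_; flip)
open import Relation.Nullary using (yes; no; contradiction)
open import Relation.Nullary.Decidable using (_×-dec_; from-yes)
open import Relation.Binary.PropositionalEquality
open import Relation.Binary.Definitions using (tri<; tri≈; tri>)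

prime⇒>1 : ∀ {p} → Prime p → 1 < p
prime⇒>1 {p} pp = nonTrivial⇒n>1 p {{prime⇒nonTrivial pp}}

prime∣prime⇒≡ : ∀ {p q} → Prime p → Prime q → p ∣ q → p ≡ q
prime∣prime⇒≡ pp pq p∣q with prime⇒irreducible pq p∣q
... | inj₁ refl = contradiction pp ¬prime[1]
... | inj₂ p≡q  = p≡q

distinctPrimes⇒∤ : ∀ {p q} → Prime p → Prime q → p ≢ q → p ∤ q
distinctPrimes⇒∤ pp pq p≢q = p≢q ∘ prime∣prime⇒≡ pp pq

prime∤-* : ∀ {p m n} → Prime p → p ∤ m → p ∤ n → p ∤ m * n
prime∤-* {m = m} {n} pp p∤m p∤n = [ p∤m , p∤n ]′ ∘ euclidsLemma m n pp

prime∤⇒coprime : ∀ {p n} → Prime p → p ∤ n → Coprime p n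
prime∤⇒coprime pp p∤n (d∣p , d∣n) with prime⇒irreducible pp d∣p
... | inj₁ d≡1 = d≡1
... | inj₂ refl = contradiction d∣n p∤n

distinctPrimes⇒coprime : ∀ {p q} → Prime p → Prime q → p ≢ q → Coprime p q
distinctPrimes⇒coprime pp pq p≢q = prime∤⇒coprime pp (distinctPrimes⇒∤ pp pq p≢q)

coprime-∣⇒≢ : ∀ {m n r s} → Coprime m n → Prime r → r ∣ m → s ∣ n → r ≢ s
coprime-∣⇒≢ cop pr r∣m r∣n refl = nonTrivial⇒≢1 {{prime⇒nonTrivial pr}} (cop (r∣m , r∣n))

∣⇒≢ : ∀ {r s y} → r ∣ y → s ∤ y → r ≢ s
∣⇒≢ r∣y s∤y refl = s∤y r∣y

*-∣-coprime : ∀ {m n o} → Coprime m n → m ∣ o → n ∣ o → m * n ∣ o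
*-∣-coprime {m} {n} cop m∣o (divides k refl)
  with divides k′ refl ← coprime-divisor cop (subst (m ∣_) (*-comm k n) m∣o)
  = divides k′ (*-assoc k′ m n)

∃prime∣ : ∀ {n} → 1 < n → ∃[ p ] Prime p × p ∣ n
∃prime∣ {1} (s≤s ())
∃prime∣ {suc (suc k)} _ with factorise (2 + k)
... | record { factors = [] ; isFactorisation = () }
... | record { factors = p ∷ ps ; isFactorisation = eq ; factorsPrime = pp ∷ _ } =
  p , pp , subst (p ∣_) (sym eq) (m∣m*n (product ps))

odd⇒≡1+2* : ∀ n → 2 ∤ n → ∃[ j ] n ≡ suc (2 * j)
odd⇒≡1+2* 0 2∤0 = contradiction (divides 0 refl) 2∤0
odd⇒≡1+2* 1 _ = 0 , refl
odd⇒≡1+2* (suc (suc n)) 2∤2+n with j , refl ← odd⇒≡1+2* n (2∤2+n ∘ ∣m∣n⇒∣m+n (∣-refl {2})) =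
  suc j , identity j
  where
  identity : ∀ j → 3 + 2 * j ≡ suc (2 * suc j)
  identity = solve-∀

1+n≤2^n : ∀ n → suc n ≤ 2 ^ n
1+n≤2^n zero = ≤-refl
1+n≤2^n (suc n) = begin
  2 + n      ≤⟨ m≤m+n (2 + n) n ⟩
  2 + n + n  ≡⟨ identity n ⟩
  2 * suc n  ≤⟨ *-monoʳ-≤ 2 (1+n≤2^n n) ⟩
  2 ^ suc n  ∎
  where
  open ≤-Reasoning
  identity : ∀ n → 2 + n + n ≡ 2 * suc n
  identity = solve-∀

repunit : ℕ → ℕ → ℕ
repunit m zero    = 0
repunit m (suc k) = repunit m k + suc m ^ k

triangular : ℕ → ℕ
triangular zero    = 0
triangular (suc k) = triangular k + k

triangular-odd : ∀ j → triangular (suc (2 * j)) ≡ suc (2 * j) * j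
triangular-odd zero = refl
triangular-odd (suc j) = begin
  triangular (suc (2 * suc j))                  ≡⟨ cong (triangular ∘ suc) (2[1+j]≡2+2j j) ⟩
  triangular (3 + 2 * j)                        ≡⟨ cong (λ t → t + suc (2 * j) + (2 + 2 * j)) (triangular-odd j) ⟩
  suc (2 * j) * j + suc (2 * j) + (2 + 2 * j)   ≡⟨ identity j ⟩
  suc (2 * suc j) * suc j                       ∎
  where
  open ≡-Reasoning
  2[1+j]≡2+2j : ∀ j → 2 * suc j ≡ 2 + 2 * j
  2[1+j]≡2+2j = solve-∀
  identity : ∀ j → suc (2 * j) * j + suc (2 * j) + (2 + 2 * j) ≡ suc (2 * suc j) * suc j
  identity = solve-∀

^≡1+*repunit : ∀ m k → suc m ^ k ≡ suc (m * repunit m k)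
^≡1+*repunit m zero = cong suc (sym (*-zeroʳ m))
^≡1+*repunit m (suc k) = begin
  suc m * suc m ^ k                ≡⟨ cong (suc m *_) (^≡1+*repunit m k) ⟩
  suc m * suc (m * R)              ≡⟨ identity m R ⟩
  suc (m * (R + suc (m * R)))      ≡⟨ cong (λ t → suc (m * (R + t))) (^≡1+*repunit m k) ⟨
  suc (m * (R + suc m ^ k))        ∎
  where
  open ≡-Reasoning
  R : ℕ
  R = repunit m k
  identity : ∀ m R → suc m * suc (m * R) ≡ suc (m * (R + suc (m * R)))
  identity = solve-∀

^-mod-m² : ∀ m k → ∃[ v ] suc m ^ k ≡ 1 + m * k + m * m * v
^-mod-m² m zero = 0 , identity m
  where
  identity : ∀ m → 1 ≡ 1 + m * 0 + m * m * 0
  identity = solve-∀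
^-mod-m² m (suc k) with v , eq ← ^-mod-m² m k = v + k + m * v , (begin
  suc m * suc m ^ k                          ≡⟨ cong (suc m *_) eq ⟩
  suc m * (1 + m * k + m * m * v)            ≡⟨ identity m k v ⟩
  1 + m * suc k + m * m * (v + k + m * v)    ∎)
  where
  open ≡-Reasoning
  identity : ∀ m k v → suc m * (1 + m * k + m * m * v) ≡ 1 + m * suc k + m * m * (v + k + m * v)
  identity = solve-∀

repunit-mod-m² : ∀ m k → ∃[ u ] repunit m k ≡ k + m * triangular k + m * m * u
repunit-mod-m² m zero = 0 , identity m
  where
  identity : ∀ m → 0 ≡ 0 + m * 0 + m * m * 0
  identity = solve-∀
repunit-mod-m² m (suc k) with u , eq ← repunit-mod-m² m k | v , eq′ ← ^-mod-m² m k =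
  u + v , (begin
  repunit m k + suc m ^ k                            ≡⟨ cong₂ _+_ eq eq′ ⟩
  k + m * T + m * m * u + (1 + m * k + m * m * v)    ≡⟨ identity m k T u v ⟩
  suc k + m * (T + k) + m * m * (u + v)              ∎)
  where
  open ≡-Reasoning
  T : ℕ
  T = triangular k
  identity : ∀ m k T u v →
             k + m * T + m * m * u + (1 + m * k + m * m * v) ≡ suc k + m * (T + k) + m * m * (u + v)
  identity = solve-∀

repunit-mod-p² : ∀ s j → let p = suc (2 * j) in ∃[ t ] repunit (s * p) p ≡ p + p * p * t
repunit-mod-p² s j with u , eq ← repunit-mod-m² (s * suc (2 * j)) (suc (2 * j)) =
  s * j + s * s * u , (begin
  repunit (s * p) p                                ≡⟨ eq ⟩
  p + s * p * triangular p + s * p * (s * p) * u   ≡⟨ cong (λ t → p + s * p * t + s * p * (s * p) * u) (triangular-odd j) ⟩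
  p + s * p * (p * j) + s * p * (s * p) * u        ≡⟨ identity p s j u ⟩
  p + p * p * (s * j + s * s * u)                  ∎)
  where
  open ≡-Reasoning
  p : ℕ
  p = suc (2 * j)
  identity : ∀ p s j u → p + s * p * (p * j) + s * p * (s * p) * u ≡ p + p * p * (s * j + s * s * u)
  identity = solve-∀

∣repunit⇒∣k : ∀ {r} m k → r ∣ m → r ∣ repunit m k → r ∣ k
∣repunit⇒∣k {r} m k r∣m r∣R with u , eq ← repunit-mod-m² m k =
  ∣m+n∣m⇒∣n (subst (r ∣_) (trans eq (identity m k (triangular k) u)) r∣R) (∣-trans r∣m (m∣m*n _))
  where
  identity : ∀ m k T u → k + m * T + m * m * u ≡ m * (T + m * u) + k
  identity = solve-∀

k<repunit : ∀ m k .{{_ : NonZero m}} → 1 < k → k < repunit m k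
k<repunit _ 1 (s≤s ())
k<repunit (suc m) 2 _ = s≤s (s≤s (s≤s z≤n))
k<repunit m (suc k@(suc (suc _))) _ =
  subst (_≤ repunit m k + suc m ^ k) (+-comm (suc k) 1)
        (+-mono-≤ (k<repunit m k (s≤s (s≤s z≤n))) (m^n>0 (suc m) k))

p²∤repunit : ∀ {m p} → 1 < p → 2 ∤ p → p ∣ m → p * p ∤ repunit m p
p²∤repunit {p = p} p>1 2∤p (divides s refl) p²∣R
  with j , refl ← odd⇒≡1+2* p 2∤p
  with t , eq ← repunit-mod-p² s j =
  <⇒≱ (m<m*n p p p>1) (∣⇒≤ (∣m+n∣m⇒∣n (subst (p * p ∣_) (trans eq (+-comm p _)) p²∣R) (m∣m*n t)))

repunit-sharedPrime : ∀ {m p r x} → Prime p → 2 ∤ m → x ∣ repunit m p →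
                      Prime r → r ∣ x → r ∣ m → r ≡ p × r * r ∤ x
repunit-sharedPrime {m} {p} pp 2∤m x∣R pr r∣x r∣m
  with refl ← prime∣prime⇒≡ pr pp (∣repunit⇒∣k m p r∣m (∣-trans r∣x x∣R)) =
  refl , λ p²∣x → p²∤repunit (prime⇒>1 pp) (λ 2∣p → 2∤m (∣-trans 2∣p r∣m)) r∣m (∣-trans p²∣x x∣R)

suc-M : ∀ a → suc (M a) ≡ 2 ^ a
suc-M a = trans (+-comm 1 (M a)) (m∸n+n≡m (m^n>0 2 a))

M<2^ : ∀ a → M a < 2 ^ a
M<2^ a = subst (M a <_) (suc-M a) (n<1+n (M a))

n≤M : ∀ n → n ≤ M n
n≤M n = ≤-pred (subst (suc n ≤_) (sym (suc-M n)) (1+n≤2^n n))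

M-nonZero : ∀ a .{{_ : NonZero a}} → NonZero (M a)
M-nonZero a = >-nonZero (≤-trans (>-nonZero⁻¹ a) (n≤M a))

M-* : ∀ a k → M (a * k) ≡ M a * repunit (M a) k
M-* a k = suc-injective (begin
  suc (M (a * k))              ≡⟨ suc-M (a * k) ⟩
  2 ^ (a * k)                  ≡⟨ ^-*-assoc 2 a k ⟨
  (2 ^ a) ^ k                  ≡⟨ cong (_^ k) (suc-M a) ⟨
  suc (M a) ^ k                ≡⟨ ^≡1+*repunit (M a) k ⟩
  suc (M a * repunit (M a) k)  ∎)
  where open ≡-Reasoning

M-+ : ∀ d e → M (d + e) ≡ M d + 2 ^ d * M e
M-+ d e = suc-injective (begin
  suc (M (d + e))                ≡⟨ suc-M (d + e) ⟩
  2 ^ (d + e)                    ≡⟨ ^-distribˡ-+-* 2 d e ⟩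
  2 ^ d * 2 ^ e                  ≡⟨ cong₂ _*_ (suc-M d) (suc-M e) ⟨
  suc (M d) * suc (M e)          ≡⟨ identity (M d) (M e) ⟩
  suc (M d + suc (M d) * M e)    ≡⟨ cong (λ t → suc (M d + t * M e)) (suc-M d) ⟩
  suc (M d + 2 ^ d * M e)        ∎)
  where
  open ≡-Reasoning
  identity : ∀ x y → suc x * suc y ≡ suc (x + suc x * y)
  identity = solve-∀

M-∣ : ∀ {d n} → d ∣ n → M d ∣ M n
M-∣ {d} (divides k refl) =
  subst (λ t → M d ∣ M t) (*-comm d k) (subst (M d ∣_) (sym (M-* d k)) (m∣m*n _))

M-odd : ∀ a .{{_ : NonZero a}} → 2 ∤ M a
M-odd (suc a) 2∣M = contradiction (∣1⇒≡1 (∣m+n∣m⇒∣n 2∣M+1 2∣M)) λ ()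
  where
  2∣M+1 : 2 ∣ M (suc a) + 1
  2∣M+1 = subst (2 ∣_) (trans (sym (suc-M (suc a))) (+-comm 1 _)) (m∣m*n (2 ^ a))

∣M-+ : ∀ {r} d e → r ∣ M (d + e) → r ∣ M e → r ∣ M d
∣M-+ {r} d e r∣M[d+e] r∣Me =
  ∣m+n∣m⇒∣n (subst (r ∣_) (trans (M-+ d e) (+-comm (M d) _)) r∣M[d+e]) (∣n⇒∣m*n (2 ^ d) r∣Me)

∣M-coprime : ∀ {r a b} c → Coprime a b → r ∣ M (a * c) → r ∣ M (b * c) → r ∣ M c
∣M-coprime {r} {a} {b} c cop = from-Bézout (coprime-Bézout cop)
  where
  scaled : ∀ {u v x y} → 1 + y * v ≡ x * u → c + y * (v * c) ≡ x * (u * c)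
  scaled {u} {v} {x} {y} eq = begin
    c + y * (v * c)  ≡⟨ identity c y v ⟩
    (1 + y * v) * c  ≡⟨ cong (_* c) eq ⟩
    x * u * c        ≡⟨ *-assoc x u c ⟩
    x * (u * c)      ∎
    where
    open ≡-Reasoning
    identity : ∀ c y v → c + y * (v * c) ≡ (1 + y * v) * c
    identity = solve-∀
  combine : ∀ {A B x y} → c + y * B ≡ x * A → r ∣ M A → r ∣ M B → r ∣ M c
  combine {x = x} {y} eq r∣MA r∣MB =
    ∣M-+ c _ (subst (λ t → r ∣ M t) (sym eq) (∣-trans r∣MA (M-∣ (n∣m*n x)))) (∣-trans r∣MB (M-∣ (n∣m*n y)))
  from-Bézout : Bézout.Identity 1 a b → r ∣ M (a * c) → r ∣ M (b * c) → r ∣ M c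
  from-Bézout (Bézout.+- x y eq) r∣Mac r∣Mbc =
    combine {a * c} {b * c} {x} {y} (scaled {a} {b} {x} {y} eq) r∣Mac r∣Mbc
  from-Bézout (Bézout.-+ x y eq) r∣Mac r∣Mbc =
    combine {b * c} {a * c} {y} {x} (scaled {b} {a} {y} {x} eq) r∣Mbc r∣Mac

M-coprime : ∀ {a b} → Coprime a b → Coprime (M a) (M b)
M-coprime {a} {b} cop {i} (i∣Ma , i∣Mb) = ∣1⇒≡1 (∣M-coprime 1 cop (∣M[x*1] a i∣Ma) (∣M[x*1] b i∣Mb))
  where
  ∣M[x*1] : ∀ x → i ∣ M x → i ∣ M (x * 1)
  ∣M[x*1] x = subst (λ t → i ∣ M t) (sym (*-identityʳ x))

M-coprime-∣⇒≢ : ∀ {a b r s} → Coprime a b → Prime r → r ∣ M a → s ∣ M b → r ≢ s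
M-coprime-∣⇒≢ = coprime-∣⇒≢ ∘ M-coprime

M-primeFactor : ∀ {p} → 1 < p → ∃[ r ] Prime r × r ∣ M p
M-primeFactor {p} p>1 = ∃prime∣ (<-≤-trans p>1 (n≤M p))

NewPrimeFactor : ℕ → ℕ → Set
NewPrimeFactor x y = ∃[ r ] Prime r × r ∣ x × r ∤ y

newPrimeFactor⊎∣ : ∀ {x y h} .{{_ : NonZero x}} →
                   (∀ {r} → Prime r → r ∣ x → r ∣ y → r ∣ h × r * r ∤ x) →
                   NewPrimeFactor x y ⊎ x ∣ h
newPrimeFactor⊎∣ {x} = go (<-wellFounded x)
  where
  go : ∀ {x y h} → Acc _<_ x → .{{NonZero x}} →
       (∀ {r} → Prime r → r ∣ x → r ∣ y → r ∣ h × r * r ∤ x) →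
       NewPrimeFactor x y ⊎ x ∣ h
  go {1} _ _ = inj₂ (1∣ _)
  go {x@(suc (suc _))} {y} {h} (acc rec) shared with ∃prime∣ {x} (s≤s (s≤s z≤n))
  ... | r , pr , r∣x with r ∣? y
  ...   | no r∤y = inj₁ (r , pr , r∣x , r∤y)
  ...   | yes r∣y = peel (shared pr r∣x r∣y)
                         (go (rec (quotient-< r∣x {{prime⇒nonTrivial pr}})) {{quotient≢0 r∣x}} shared′)
    where
    x′ : ℕ
    x′ = quotient r∣x
    x≡x′r : x ≡ x′ * r
    x≡x′r = m∣n⇒n≡quotient*m r∣x
    x′∣x : x′ ∣ x
    x′∣x = quotient-∣ r∣x
    shared′ : ∀ {r′} → Prime r′ → r′ ∣ x′ → r′ ∣ y → r′ ∣ h × r′ * r′ ∤ x′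
    shared′ pr′ r′∣x′ r′∣y =
      map₂ (λ r′²∤x → r′²∤x ∘ flip ∣-trans x′∣x) (shared pr′ (∣-trans r′∣x′ x′∣x) r′∣y)
    peel : r ∣ h × r * r ∤ x → NewPrimeFactor x′ y ⊎ x′ ∣ h → NewPrimeFactor x y ⊎ x ∣ h
    peel _ (inj₁ (r′ , pr′ , r′∣x′ , r′∤y)) = inj₁ (r′ , pr′ , ∣-trans r′∣x′ x′∣x , r′∤y)
    peel (r∣h , r²∤x) (inj₂ x′∣h) = inj₂ (subst (_∣ h) (sym x≡x′r) (*-∣-coprime x′⊥r x′∣h r∣h))
      where
      x′⊥r : Coprime x′ r
      x′⊥r = Coprimality.sym (prime∤⇒coprime pr λ r∣x′ →
        r²∤x (subst (r * r ∣_) (sym x≡x′r) (*-monoˡ-∣ r r∣x′)))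

M-newPrimeFactor-* : ∀ {p} a .{{_ : NonZero a}} → Prime p → NewPrimeFactor (M (p * a)) (M a)
M-newPrimeFactor-* {p} a pp = conclude (newPrimeFactor⊎∣ {{R≢0}} shared)
  where
  instance
    Ma≢0 : NonZero (M a)
    Ma≢0 = M-nonZero a
  R : ℕ
  R = repunit (M a) p
  p<R : p < R
  p<R = k<repunit (M a) p (prime⇒>1 pp)
  R≢0 : NonZero R
  R≢0 = >-nonZero (≤-trans (s≤s z≤n) p<R)
  shared : ∀ {r} → Prime r → r ∣ R → r ∣ M a → r ∣ p × r * r ∤ R
  shared pr r∣R r∣Ma = map₁ ∣-reflexive (repunit-sharedPrime pp (M-odd a) ∣-refl pr r∣R r∣Ma)
  conclude : NewPrimeFactor R (M a) ⊎ R ∣ p → NewPrimeFactor (M (p * a)) (M a)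
  conclude (inj₁ (r , pr , r∣R , r∤Ma)) =
    r , pr , subst (r ∣_) (trans (sym (M-* a p)) (cong M (*-comm a p))) (∣n⇒∣m*n (M a) r∣R) , r∤Ma
  conclude (inj₂ R∣p) = contradiction (∣⇒≤ {{prime⇒nonZero pp}} R∣p) (<⇒≱ p<R)

M-newPrimeFactor-pq-bounded : ∀ {p q} → Prime p → Prime q → p ≢ q →
                              M p * (p * q) < repunit (M q) p →
                              NewPrimeFactor (M (p * q)) (M p * M q)
M-newPrimeFactor-pq-bounded {p} {q} pp pq p≢q bound = conclude (newPrimeFactor⊎∣ {{Φ≢0}} shared)
  where
  instance
    p≢0 : NonZero p
    p≢0 = prime⇒nonZero pp
    q≢0 : NonZero q
    q≢0 = prime⇒nonZero pq
    Mp≢0 : NonZero (M p)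
    Mp≢0 = M-nonZero p
    Mq≢0 : NonZero (M q)
    Mq≢0 = M-nonZero q
  Rpq Rqp : ℕ
  Rpq = repunit (M p) q
  Rqp = repunit (M q) p
  Mq∣Rpq : M q ∣ Rpq
  Mq∣Rpq = coprime-divisor (M-coprime (distinctPrimes⇒coprime pq pp (≢-sym p≢q)))
                           (subst (M q ∣_) (M-* p q) (M-∣ (n∣m*n p)))
  Φ : ℕ
  Φ = quotient Mq∣Rpq
  Φ≢0 : NonZero Φ
  Φ≢0 = quotient≢0 Mq∣Rpq {{>-nonZero (≤-trans (s≤s z≤n) (k<repunit (M p) q (prime⇒>1 pq)))}}
  Rqp≡MpΦ : Rqp ≡ M p * Φ
  Rqp≡MpΦ = *-cancelˡ-≡ Rqp (M p * Φ) (M q) (begin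
    M q * Rqp          ≡⟨ M-* q p ⟨
    M (q * p)          ≡⟨ cong M (*-comm q p) ⟩
    M (p * q)          ≡⟨ M-* p q ⟩
    M p * Rpq          ≡⟨ cong (M p *_) (m∣n⇒n≡quotient*m Mq∣Rpq) ⟩
    M p * (Φ * M q)    ≡⟨ *-assoc (M p) Φ (M q) ⟨
    M p * Φ * M q      ≡⟨ *-comm (M p * Φ) (M q) ⟩
    M q * (M p * Φ)    ∎)
    where open ≡-Reasoning
  Φ∣Rpq : Φ ∣ Rpq
  Φ∣Rpq = quotient-∣ Mq∣Rpq
  Φ∣Rqp : Φ ∣ Rqp
  Φ∣Rqp = divides (M p) Rqp≡MpΦ
  shared : ∀ {r} → Prime r → r ∣ Φ → r ∣ M p * M q → r ∣ p * q × r * r ∤ Φ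
  shared pr r∣Φ r∣MpMq with euclidsLemma (M p) (M q) pr r∣MpMq
  ... | inj₁ r∣Mp = map₁ (λ { refl → n∣m*n p }) (repunit-sharedPrime pq (M-odd p) Φ∣Rpq pr r∣Φ r∣Mp)
  ... | inj₂ r∣Mq = map₁ (λ { refl → m∣m*n q }) (repunit-sharedPrime pp (M-odd q) Φ∣Rqp pr r∣Φ r∣Mq)
  conclude : NewPrimeFactor Φ (M p * M q) ⊎ Φ ∣ p * q → NewPrimeFactor (M (p * q)) (M p * M q)
  conclude (inj₁ (r , pr , r∣Φ , r∤MpMq)) =
    r , pr , subst (r ∣_) (sym (M-* p q)) (∣n⇒∣m*n (M p) (∣-trans r∣Φ Φ∣Rpq)) , r∤MpMq
  conclude (inj₂ Φ∣pq) = contradiction bound (≤⇒≯ (begin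
    Rqp            ≡⟨ Rqp≡MpΦ ⟩
    M p * Φ        ≤⟨ *-monoʳ-≤ (M p) (∣⇒≤ {{m*n≢0 p q}} Φ∣pq) ⟩
    M p * (p * q)  ∎))
    where open ≤-Reasoning

6*[5+k]≤2^[5+k] : ∀ k → 6 * (5 + k) ≤ 2 ^ (5 + k)
6*[5+k]≤2^[5+k] k = begin
  6 * (5 + k)                ≤⟨ m≤m+n (6 * (5 + k)) (2 + 26 * k) ⟩
  6 * (5 + k) + (2 + 26 * k) ≡⟨ identity k ⟩
  32 * suc k                 ≤⟨ *-monoʳ-≤ 32 (1+n≤2^n k) ⟩
  32 * 2 ^ k                 ≡⟨ ^-distribˡ-+-* 2 5 k ⟨
  2 ^ (5 + k)                ∎
  where
  open ≤-Reasoning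
  identity : ∀ k → 6 * (5 + k) + (2 + 26 * k) ≡ 32 * suc k
  identity = solve-∀

-- R_{M q}(p) ≥ 2^{q(p−1)}, which beats 2^p · pq once p ≥ 3; for p = 2 it is 1 + 2^q, which beats
-- 6q only when q ≥ 5.
repunit-bound : ∀ {p q} → 1 < p → p < q → 4 < q → M p * (p * q) < repunit (M q) p
repunit-bound {2} {q@(suc (suc (suc (suc (suc k)))))} _ _ _ = begin-strict
  3 * (2 * q)          ≡⟨ *-assoc 3 2 q ⟨
  6 * q                ≤⟨ 6*[5+k]≤2^[5+k] k ⟩
  2 ^ q                ≡⟨ suc-M q ⟨
  suc (M q)            ≡⟨ *-identityʳ (suc (M q)) ⟨
  suc (M q) * 1        <⟨ n<1+n _ ⟩
  repunit (M q) 2      ∎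
  where open ≤-Reasoning
repunit-bound {p@(suc (suc (suc a)))} {q@(suc q′@(suc (suc (suc b))))} _ _ _ = begin-strict
  M p * (p * q)                     <⟨ *-monoˡ-< (p * q) (M<2^ p) ⟩
  2 ^ p * (p * q)                   ≤⟨ *-monoʳ-≤ (2 ^ p) (*-mono-≤ (1+n≤2^n (2 + a)) (1+n≤2^n q′)) ⟩
  2 ^ p * (2 ^ (2 + a) * 2 ^ q′)    ≡⟨ cong (2 ^ p *_) (^-distribˡ-+-* 2 (2 + a) q′) ⟨
  2 ^ p * 2 ^ (2 + a + q′)          ≡⟨ ^-distribˡ-+-* 2 p (2 + a + q′) ⟨
  2 ^ (p + (2 + a + q′))            ≤⟨ ^-monoʳ-≤ 2 exponent ⟩
  2 ^ (q * (2 + a))                 ≡⟨ ^-*-assoc 2 q (2 + a) ⟨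
  (2 ^ q) ^ (2 + a)                 ≡⟨ cong (_^ (2 + a)) (suc-M q) ⟨
  suc (M q) ^ (2 + a)               ≤⟨ m≤n+m _ (repunit (M q) (2 + a)) ⟩
  repunit (M q) p                   ∎
  where
  open ≤-Reasoning
  identity : ∀ a b → (4 + b) * (2 + a) ≡ (3 + a + (2 + a + (3 + b))) + (2 * a + b + a * b)
  identity = solve-∀
  exponent : p + (2 + a + q′) ≤ q * (2 + a)
  exponent = subst (p + (2 + a + q′) ≤_) (sym (identity a b)) (m≤m+n _ _)
repunit-bound {1} (s≤s ()) _ _
repunit-bound {suc _} {1} _ _ (s≤s ())
repunit-bound {suc _} {2} _ _ (s≤s (s≤s ()))
repunit-bound {suc _} {3} _ _ (s≤s (s≤s (s≤s ())))
repunit-bound {suc _} {4} _ _ (s≤s (s≤s (s≤s (s≤s ()))))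

prime>4 : ∀ {p q} → 1 < p → p < q → Prime q → p * q ≢ 6 → 4 < q
prime>4 {q = suc (suc (suc (suc (suc _))))} _ _ _ _ = s≤s (s≤s (s≤s (s≤s (s≤s z≤n))))
prime>4 {q = 4} _ _ q-prime _ = contradiction q-prime (composite⇒¬prime composite[4])
prime>4 {2} {3} _ _ _ pq≢6 = contradiction refl pq≢6
prime>4 {suc (suc (suc _))} {3} _ (s≤s (s≤s (s≤s ()))) _ _
prime>4 {1} (s≤s ()) _ _ _
prime>4 {suc (suc _)} {2} _ (s≤s (s≤s ())) _ _
prime>4 {suc (suc _)} {1} _ (s≤s ()) _ _

M-newPrimeFactor-pq-< : ∀ {p q} → Prime p → Prime q → p < q → p * q ≢ 6 →
                        NewPrimeFactor (M (p * q)) (M p * M q)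
M-newPrimeFactor-pq-< {p} pp pq p<q pq≢6 =
  M-newPrimeFactor-pq-bounded pp pq (<⇒≢ p<q) (repunit-bound p>1 p<q (prime>4 p>1 p<q pq pq≢6))
  where
  p>1 : 1 < p
  p>1 = prime⇒>1 pp

M-newPrimeFactor-pq : ∀ {p q} → Prime p → Prime q → p ≢ q → p * q ≢ 6 →
                      NewPrimeFactor (M (p * q)) (M p * M q)
M-newPrimeFactor-pq {p} {q} pp pq p≢q pq≢6 with <-cmp p q
... | tri< p<q _ _ = M-newPrimeFactor-pq-< pp pq p<q pq≢6
... | tri≈ _ p≡q _ = contradiction p≡q p≢q
... | tri> _ _ q<p = subst₂ NewPrimeFactor (cong M (*-comm q p)) (*-comm (M q) (M p))
                            (M-newPrimeFactor-pq-< pq pp q<p (pq≢6 ∘ trans (*-comm p q)))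

∈-remove : ∀ {A : Set} {x : A} {ys} → x ∈ ys →
           ∃[ zs ] length ys ≡ suc (length zs) × (∀ {y} → y ∈ ys → y ≢ x → y ∈ zs)
∈-remove {ys = _ ∷ zs} (here refl) =
  zs , refl , λ { (here refl) y≢x → contradiction refl y≢x ; (there y∈zs) _ → y∈zs }
∈-remove {ys = z ∷ _} (there x∈ys) with zs , len , keep ← ∈-remove x∈ys =
  z ∷ zs , cong suc len , λ { (here refl) _ → here refl ; (there y∈ys) y≢x → there (keep y∈ys y≢x) }

unique-⊆⇒length-≤ : ∀ {A : Set} {xs ys : List A} → Unique xs → xs ⊆ ys → length xs ≤ length ys
unique-⊆⇒length-≤ [] _ = z≤n
unique-⊆⇒length-≤ {xs = x ∷ xs} (x≢xs ∷ unique) x∷xs⊆ys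
  with zs , len , keep ← ∈-remove (x∷xs⊆ys (here refl)) =
  subst (suc (length xs) ≤_) (sym len) (s≤s (unique-⊆⇒length-≤ unique xs⊆zs))
  where
  xs⊆zs : xs ⊆ zs
  xs⊆zs y∈xs = keep (x∷xs⊆ys (there y∈xs)) (≢-sym (All.lookup x≢xs y∈xs))

DistinctPrimeFactors : ℕ → ℕ → Set
DistinctPrimeFactors k m = ∃[ ps ] length ps ≡ k × Unique ps × All (λ r → Prime r × r ∣ m) ps

≤ω : ∀ {k m} .{{_ : NonZero m}} → DistinctPrimeFactors k m → k ≤ ω m
≤ω {m = m} (ps , refl , unique , ps-prime∣m) = unique-⊆⇒length-≤ unique ps⊆
  where
  ps⊆ : ps ⊆ filter (λ p → prime? p ×-dec p ∣? m) (upTo (suc m))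
  ps⊆ r∈ps with pr , r∣m ← All.lookup ps-prime∣m r∈ps =
    ∈-filter⁺ (λ p → prime? p ×-dec p ∣? m) (∈-upTo⁺ (s≤s (∣⇒≤ r∣m))) (pr , r∣m)

distinctPrimeFactors-∣ : ∀ {k m n} → m ∣ n → DistinctPrimeFactors k m → DistinctPrimeFactors k n
distinctPrimeFactors-∣ m∣n (ps , len , unique , ps-prime∣m) =
  ps , len , unique , All.map (map₂ (flip ∣-trans m∣n)) ps-prime∣m

M[p^k]-primeFactors : ∀ {p} → Prime p → ∀ k → DistinctPrimeFactors k (M (p ^ k))
M[p^k]-primeFactors pp zero = [] , refl , [] , []
M[p^k]-primeFactors {p} pp (suc k)
  with ps , len , unique , ps-ok ← M[p^k]-primeFactors pp k
     | r , pr , r∣M[p^1+k] , r∤M[p^k] ←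
         M-newPrimeFactor-* (p ^ k) {{m^n≢0 p k {{prime⇒nonZero pp}}}} pp =
  r ∷ ps , cong suc len ,
  All.map (λ (_ , q∣M[p^k]) → ≢-sym (∣⇒≢ q∣M[p^k] r∤M[p^k])) ps-ok ∷ unique ,
  (pr , r∣M[p^1+k]) ∷ All.map (map₂ (flip ∣-trans (M-∣ (n∣m*n p)))) ps-ok

M[pqr]-primeFactors-≢6 : ∀ {p q r} → Prime p → Prime q → Prime r → p ≢ q → p ≢ r → q ≢ r →
                         p * q ≢ 6 → DistinctPrimeFactors 4 (M (p * q * r))
M[pqr]-primeFactors-≢6 {p} {q} {r} pp pq pr p≢q p≢r q≢r pq≢6
  with M-primeFactor (prime⇒>1 pp) | M-primeFactor (prime⇒>1 pq) | M-primeFactor (prime⇒>1 pr)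
     | M-newPrimeFactor-pq pp pq p≢q pq≢6
... | a , pa , a∣Mp | b , pb , b∣Mq | c , pc , c∣Mr | s , ps , s∣Mpq , s∤MpMq =
  a ∷ b ∷ c ∷ s ∷ [] , refl ,
  (a≢b ∷ a≢c ∷ a≢s ∷ []) ∷ (b≢c ∷ b≢s ∷ []) ∷ (c≢s ∷ []) ∷ [] ∷ [] ,
  (pa , ∣-trans a∣Mp (M-∣ (∣m⇒∣m*n r (m∣m*n {p} q)))) ∷
  (pb , ∣-trans b∣Mq (M-∣ (∣m⇒∣m*n r (n∣m*n p)))) ∷
  (pc , ∣-trans c∣Mr (M-∣ (n∣m*n (p * q)))) ∷
  (ps , ∣-trans s∣Mpq (M-∣ (m∣m*n {p * q} r))) ∷ []
  where
  a≢b : a ≢ b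
  a≢b = M-coprime-∣⇒≢ (distinctPrimes⇒coprime pp pq p≢q) pa a∣Mp b∣Mq
  a≢c : a ≢ c
  a≢c = M-coprime-∣⇒≢ (distinctPrimes⇒coprime pp pr p≢r) pa a∣Mp c∣Mr
  b≢c : b ≢ c
  b≢c = M-coprime-∣⇒≢ (distinctPrimes⇒coprime pq pr q≢r) pb b∣Mq c∣Mr
  a≢s : a ≢ s
  a≢s = ∣⇒≢ (∣m⇒∣m*n (M q) a∣Mp) s∤MpMq
  b≢s : b ≢ s
  b≢s = ∣⇒≢ (∣n⇒∣m*n (M p) b∣Mq) s∤MpMq
  c≢s : c ≢ s
  c≢s = M-coprime-∣⇒≢ r⊥pq pc c∣Mr s∣Mpq
    where
    r⊥pq : Coprime r (p * q)
    r⊥pq = prime∤⇒coprime pr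
             (prime∤-* pr (distinctPrimes⇒∤ pr pp (≢-sym p≢r)) (distinctPrimes⇒∤ pr pq (≢-sym q≢r)))

M[pqr]-primeFactors : ∀ {p q r} → Prime p → Prime q → Prime r → p ≢ q → p ≢ r → q ≢ r →
                      DistinctPrimeFactors 4 (M (p * q * r))
M[pqr]-primeFactors {p} {q} {r} pp pq pr p≢q p≢r q≢r with p * q ≟ 6
... | no pq≢6 = M[pqr]-primeFactors-≢6 pp pq pr p≢q p≢r q≢r pq≢6
... | yes pq≡6 = subst (DistinctPrimeFactors 4 ∘ M) (*-comm-swap p r q)
                       (M[pqr]-primeFactors-≢6 pp pr pq p≢r p≢q (≢-sym q≢r) pr≢6)
  where
  pr≢6 : p * r ≢ 6
  pr≢6 pr≡6 = q≢r (*-cancelˡ-≡ q r p {{prime⇒nonZero pp}} (trans pq≡6 (sym pr≡6)))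
  *-comm-swap : ∀ x y z → x * y * z ≡ x * z * y
  *-comm-swap = solve-∀

prime*≡6 : ∀ {p q} → Prime p → p * q ≡ 6 → (p ≡ 2 × q ≡ 3) ⊎ (p ≡ 3 × q ≡ 2)
prime*≡6 {p} {q} pp pq≡6 with euclidsLemma 2 3 pp (divides q (trans (sym pq≡6) (*-comm p q)))
... | inj₁ p∣2 with refl ← prime∣prime⇒≡ pp prime[2] p∣2 = inj₁ (refl , *-cancelˡ-≡ q 3 2 pq≡6)
... | inj₂ p∣3 with refl ← prime∣prime⇒≡ pp (from-yes (prime? 3)) p∣3 =
  inj₂ (refl , *-cancelˡ-≡ q 2 3 pq≡6)

M12-primeFactors : DistinctPrimeFactors 4 (M 12)
M12-primeFactors =
  ps , refl , from-yes (unique? ps) , from-yes (All.all? (λ r → prime? r ×-dec r ∣? M 12) ps)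
  where
  ps : List ℕ
  ps = 3 ∷ 5 ∷ 7 ∷ 13 ∷ []

M18-primeFactors : DistinctPrimeFactors 4 (M 18)
M18-primeFactors =
  ps , refl , from-yes (unique? ps) , from-yes (All.all? (λ r → prime? r ×-dec r ∣? M 18) ps)
  where
  ps : List ℕ
  ps = 3 ∷ 7 ∷ 19 ∷ 73 ∷ []

M[pq²]-primeFactors-≢6 : ∀ {p q} → Prime p → Prime q → p ≢ q → p * q ≢ 6 →
                         DistinctPrimeFactors 4 (M (p * q ^ 2))
M[pq²]-primeFactors-≢6 {p} {q} pp pq p≢q pq≢6
  with M-primeFactor (prime⇒>1 pp) | M-primeFactor (prime⇒>1 pq)
     | M-newPrimeFactor-* q {{prime⇒nonZero pq}} pq | M-newPrimeFactor-pq pp pq p≢q pq≢6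
... | a , pa , a∣Mp | b , pb , b∣Mq | w , pw , w∣Mqq , w∤Mq | s , ps , s∣Mpq , s∤MpMq =
  a ∷ b ∷ w ∷ s ∷ [] , refl ,
  (a≢b ∷ a≢w ∷ a≢s ∷ []) ∷ (b≢w ∷ b≢s ∷ []) ∷ (w≢s ∷ []) ∷ [] ∷ [] ,
  (pa , ∣-trans a∣Mp (M-∣ (m∣m*n {p} (q ^ 2)))) ∷
  (pb , ∣-trans b∣Mq (M-∣ (∣n⇒∣m*n p q∣q²))) ∷
  (pw , ∣-trans w∣Mqq (M-∣ (∣n⇒∣m*n p q*q∣q²))) ∷
  (ps , ∣-trans s∣Mpq (M-∣ (*-monoʳ-∣ p q∣q²))) ∷ []
  where
  q∣q² : q ∣ q ^ 2
  q∣q² = m∣m*n (q * 1)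
  q*q∣q² : q * q ∣ q ^ 2
  q*q∣q² = ∣-reflexive (cong (q *_) (sym (*-identityʳ q)))
  p⊥q : Coprime p q
  p⊥q = distinctPrimes⇒coprime pp pq p≢q
  a≢b : a ≢ b
  a≢b = M-coprime-∣⇒≢ p⊥q pa a∣Mp b∣Mq
  a≢w : a ≢ w
  a≢w = M-coprime-∣⇒≢ (prime∤⇒coprime pp (prime∤-* pp p∤q p∤q)) pa a∣Mp w∣Mqq
    where
    p∤q : p ∤ q
    p∤q = distinctPrimes⇒∤ pp pq p≢q
  a≢s : a ≢ s
  a≢s = ∣⇒≢ (∣m⇒∣m*n (M q) a∣Mp) s∤MpMq
  b≢w : b ≢ w
  b≢w = ∣⇒≢ b∣Mq w∤Mq
  b≢s : b ≢ s
  b≢s = ∣⇒≢ (∣n⇒∣m*n (M p) b∣Mq) s∤MpMq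
  w≢s : w ≢ s
  w≢s refl = s∤MpMq (∣n⇒∣m*n (M p) (∣M-coprime q p⊥q s∣Mpq w∣Mqq))

M[pq²]-primeFactors : ∀ {p q} → Prime p → Prime q → p ≢ q → DistinctPrimeFactors 4 (M (p * q ^ 2))
M[pq²]-primeFactors {p} {q} pp pq p≢q with p * q ≟ 6
... | no pq≢6 = M[pq²]-primeFactors-≢6 pp pq p≢q pq≢6
... | yes pq≡6 with prime*≡6 pp pq≡6
...   | inj₁ (refl , refl) = M18-primeFactors
...   | inj₂ (refl , refl) = M12-primeFactors

ω[M]-∣ : ∀ {k d n} → 0 < n → d ∣ n → DistinctPrimeFactors k (M d) → k ≤ ω (M n)
ω[M]-∣ {n = n} n>0 d∣n = ≤ω {{M-nonZero n {{>-nonZero n>0}}}} ∘ distinctPrimeFactors-∣ (M-∣ d∣n)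

proposition4 : (n : ℕ) → 0 < n →
    ((∃[ p₁ ] Prime p₁ × p₁ ^ 4 ∣ n)
     ⊎ (∃[ p₁ ] ∃[ p₂ ] ∃[ p₃ ] Prime p₁ × Prime p₂ × Prime p₃ × p₁ ≢ p₂ × p₁ ≢ p₃ × p₂ ≢ p₃ × p₁ * p₂ * p₃ ∣ n)
     ⊎ (∃[ p₁ ] ∃[ p₂ ] Prime p₁ × Prime p₂ × p₁ ≢ p₂ × p₁ * p₂ ^ 2 ∣ n)) →
    3 < ω (M n)
proposition4 n n>0 (inj₁ (p , pp , p⁴∣n)) =
  ω[M]-∣ n>0 p⁴∣n (M[p^k]-primeFactors pp 4)
proposition4 n n>0 (inj₂ (inj₁ (p , q , r , pp , pq , pr , p≢q , p≢r , q≢r , pqr∣n))) =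
  ω[M]-∣ n>0 pqr∣n (M[pqr]-primeFactors pp pq pr p≢q p≢r q≢r)
proposition4 n n>0 (inj₂ (inj₂ (p , q , pp , pq , p≢q , pq²∣n))) =
  ω[M]-∣ n>0 pq²∣n (M[pq²]-primeFactors pp pq p≢q)
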